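{- Let $(\mathbf{C},\mathcal M)$ be an $\mathcal M$-adhesive category with binary coproducts. Let $p_1=(L_1\leftarrow I_1\rightarrow R_1)$ and $p_2=(L_2\leftarrow I_2\rightarrow R_2)$ be plain rules, and let $tp\colon H_1\Leftarrow_{p_1,m_1}G\Rightarrow_{p_2,m_2}H_2$ be a parallel independent pair of plain direct transformations. Let $i_1\colon L_1\to L_1+L_2$ and $i_2\colon L_2\to L_1+L_2$ be the coproduct injections, and let $tp_{L_1+L_2}\colon R_1+L_2\Leftarrow_{p_1,i_1}L_1+L_2\Rightarrow_{p_2,i_2}L_1+R_2$ be the pair of plain direct transformations obtained by applying $p_1$ at $i_1$ and $p_2$ at $i_2$. Then $tp_{L_1+L_2}$ is an initial transformation pair for $tp$.
   Context: An $\mathcal M$-adhesive category is a category with a distinguished class $\mathcal M$ of monomorphisms satisfying the standard axioms (closure properties and the van Kampen property for pushouts along $\mathcal M$-morphisms). A plain rule $p=(L\leftarrow I\rightarrow R)$ has both morphisms in $\mathcal M$. A plain direct transformation $G\Rightarrow_{p,m}H$ with match $m\colon L\to G$ is a double pushout diagram: pushouts $L\leftarrow I\to D$, $G$ and $R\leftarrow I\to D$, $H$, giving $k\colon D\to G$ and $c\colon D\to H$. A pair $H_1\Leftarrow_{p_1,m_1}G\Rightarrow_{p_2,m_2}H_2$ (with $k_i\colon D_i\to G$) is parallel independent if there exist $d_{12}\colon L_1\to D_2$ with $k_2\circ d_{12}=m_1$ and $d_{21}\colon L_2\to D_1$ with $k_1\circ d_{21}=m_2$; otherwise it is in conflict.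 Embedding / extension diagram: a pair $tp'\colon P_1\Leftarrow_{p_1,o_1}K\Rightarrow_{p_2,o_2}P_2$ can be embedded into $tp\colon H_1\Leftarrow_{p_1,m_1}G\Rightarrow_{p_2,m_2}H_2$ via extension morphism $f\colon K\to G$ if $m_j=f\circ o_j$ ($j=1,2$) and for each $j$ there are morphisms from the intermediate object and result object of the $j$-th upper transformation to those of the $j$-th lower one such that all squares between the two double pushout diagrams commute and are pushouts (extension diagrams). Initial transformation pair: given $tp$, a pair $tp^I$ is an initial transformation pair for $tp$ if $tp^I$ can be embedded into $tp$ via some extension morphism $f^I$, and for every pair $tp'$ that can be embedded into $tp$ via an extension morphism $f$, there are unique extension diagrams embedding $tp^I$ into $tp'$ via a unique morphism $f'^I$ with $f\circ f'^I=f^I$. -}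

module Defs where

open import Level using (Level; _⊔_; suc)
open import Data.Product using (Σ; Σ-syntax; _×_; _,_)
open import Relation.Binary using (Rel; IsEquivalence)

record Category (o ℓ e : Level) : Set (suc (o ⊔ ℓ ⊔ e)) where
  infixr 9 _∘_
  infix 4 _≈_
  field
    Obj   : Set o
    Hom   : Obj → Obj → Set ℓ
    _≈_   : ∀ {A B} → Rel (Hom A B) e
    id    : ∀ {A} → Hom A A
    _∘_   : ∀ {A B C} → Hom B C → Hom A B → Hom A C
    ≈-equiv   : ∀ {A B} → IsEquivalence (_≈_ {A} {B})
    ∘-resp-≈  : ∀ {A B C} {f h : Hom B C} {g i : Hom A B} →
                f ≈ h → g ≈ i → f ∘ g ≈ h ∘ i
    identityˡ : ∀ {A B} {f : Hom A B} → id ∘ f ≈ f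
    identityʳ : ∀ {A B} {f : Hom A B} → f ∘ id ≈ f
    assoc     : ∀ {A B C D} {f : Hom A B} {g : Hom B C} {h : Hom C D} →
                (h ∘ g) ∘ f ≈ h ∘ (g ∘ f)

module CatDefs {o ℓ e : Level} (𝒞 : Category o ℓ e) where
  open Category 𝒞

  Mono : ∀ {A B} → Hom A B → Set (o ⊔ ℓ ⊔ e)
  Mono {A} f = ∀ {X} (g h : Hom X A) → f ∘ g ≈ f ∘ h → g ≈ h

  IsIso : ∀ {A B} → Hom A B → Set (ℓ ⊔ e)
  IsIso {A} {B} f = Σ[ g ∈ Hom B A ] (g ∘ f ≈ id × f ∘ g ≈ id)

  IsPushout : ∀ {A B C P} → Hom A B → Hom A C → Hom B P → Hom C P → Set (o ⊔ ℓ ⊔ e)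
  IsPushout {A} {B} {C} {P} f g i₁ i₂ =
    (i₁ ∘ f ≈ i₂ ∘ g) ×
    (∀ {Q} (h₁ : Hom B Q) (h₂ : Hom C Q) → h₁ ∘ f ≈ h₂ ∘ g →
      Σ[ u ∈ Hom P Q ] ((u ∘ i₁ ≈ h₁) × (u ∘ i₂ ≈ h₂) ×
        (∀ (v : Hom P Q) → v ∘ i₁ ≈ h₁ → v ∘ i₂ ≈ h₂ → v ≈ u)))

  IsPullback : ∀ {B C D P} → Hom B D → Hom C D → Hom P B → Hom P C → Set (o ⊔ ℓ ⊔ e)
  IsPullback {B} {C} {D} {P} f g p₁ p₂ =
    (f ∘ p₁ ≈ g ∘ p₂) ×
    (∀ {Q} (h₁ : Hom Q B) (h₂ : Hom Q C) → f ∘ h₁ ≈ g ∘ h₂ →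
      Σ[ u ∈ Hom Q P ] ((p₁ ∘ u ≈ h₁) × (p₂ ∘ u ≈ h₂) ×
        (∀ (v : Hom Q P) → p₁ ∘ v ≈ h₁ → p₂ ∘ v ≈ h₂ → v ≈ u)))

  record BinaryCoproducts : Set (o ⊔ ℓ ⊔ e) where
    field
      _+_   : Obj → Obj → Obj
      inj₁  : ∀ {A B} → Hom A (A + B)
      inj₂  : ∀ {A B} → Hom B (A + B)
      [_,_] : ∀ {A B X} → Hom A X → Hom B X → Hom (A + B) X
      inject₁ : ∀ {A B X} {f : Hom A X} {g : Hom B X} → [ f , g ] ∘ inj₁ ≈ f
      inject₂ : ∀ {A B X} {f : Hom A X} {g : Hom B X} → [ f , g ] ∘ inj₂ ≈ g
      unique  : ∀ {A B X} {f : Hom A X} {g : Hom B X} (h : Hom (A + B) X) →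
                h ∘ inj₁ ≈ f → h ∘ inj₂ ≈ g → h ≈ [ f , g ]

record MAdhesive {o ℓ e : Level} (𝒞 : Category o ℓ e) (m : Level)
       : Set (suc m ⊔ o ⊔ ℓ ⊔ e) where
  open Category 𝒞
  open CatDefs 𝒞
  field
    M         : ∀ {A B} → Hom A B → Set m
    M-resp-≈  : ∀ {A B} {f g : Hom A B} → f ≈ g → M f → M g
    M-mono    : ∀ {A B} {f : Hom A B} → M f → Mono f
    M-iso     : ∀ {A B} {f : Hom A B} → IsIso f → M f
    M-comp    : ∀ {A B C} {f : Hom A B} {g : Hom B C} → M f → M g → M (g ∘ f)
    M-decomp  : ∀ {A B C} {f : Hom A B} {g : Hom B C} → M (g ∘ f) → M g → M f
    pushout-along-M : ∀ {A B C} (f : Hom A B) (m′ : Hom A C) → M m′ →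
      Σ[ P ∈ Obj ] Σ[ i₁ ∈ Hom B P ] Σ[ i₂ ∈ Hom C P ] IsPushout f m′ i₁ i₂
    pullback-along-M : ∀ {B C D} (f : Hom B D) (m′ : Hom C D) → M m′ →
      Σ[ P ∈ Obj ] Σ[ p₁ ∈ Hom P B ] Σ[ p₂ ∈ Hom P C ] IsPullback f m′ p₁ p₂
    M-pushout-stable : ∀ {A B C P} {f : Hom A B} {m′ : Hom A C}
      {n : Hom B P} {g : Hom C P} → IsPushout f m′ n g → M m′ → M n
    M-pullback-stable : ∀ {B C D P} {f : Hom B D} {m′ : Hom C D}
      {p₁ : Hom P B} {p₂ : Hom P C} → IsPullback f m′ p₁ p₂ → M m′ → M p₁
    -- vertical weak van Kampen property.  Bottom face: pushout
    --   B <-f- A -m′-> C,  n : B → D, g : C → D  with m′ ∈ M;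
    -- top face A' B' C' D' with f', m'', n', g'; vertical a, b, c, d.
    vertical-weak-VK :
      ∀ {A B C D A' B' C' D'}
        {f : Hom A B} {m′ : Hom A C} {n : Hom B D} {g : Hom C D}
        {f' : Hom A' B'} {m'' : Hom A' C'} {n' : Hom B' D'} {g' : Hom C' D'}
        {a : Hom A' A} {b : Hom B' B} {c : Hom C' C} {d : Hom D' D} →
      IsPushout f m′ n g → M m′ →
      n' ∘ f' ≈ g' ∘ m'' →
      f ∘ a ≈ b ∘ f' → m′ ∘ a ≈ c ∘ m'' →
      n ∘ b ≈ d ∘ n' → g ∘ c ≈ d ∘ g' →
      M b → M c → M d →
      -- back faces pullbacks
      IsPullback f b a f' → IsPullback m′ c a m'' →
      -- top pushout  ⇔  front faces pullbacks
      ((IsPushout f' m'' n' g' → IsPullback n d b n' × IsPullback g d c g') ×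
       (IsPullback n d b n' × IsPullback g d c g' → IsPushout f' m'' n' g'))

module Transformations {o ℓ e m : Level} {𝒞 : Category o ℓ e} (𝓜 : MAdhesive 𝒞 m) where
  open Category 𝒞
  open CatDefs 𝒞
  open MAdhesive 𝓜

  record Rule : Set (o ⊔ ℓ ⊔ m) where
    field
      L I R : Obj
      l : Hom I L
      r : Hom I R
      l∈M : M l
      r∈M : M r

  -- plain direct transformation G ⇒_{p,mt} H as a double pushout diagram
  --   L <-l- I -r-> R
  --   |mt    |u     |n
  --   G <-k- D -c-> H
  record DPO (p : Rule) (G : Obj) (mt : Hom (Rule.L p) G) : Set (o ⊔ ℓ ⊔ e ⊔ m) where
    open Rule p
    field
      D H : Obj
      u : Hom I D
      k : Hom D G
      c : Hom D H
      n : Hom R H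
      po₁ : IsPushout l u mt k
      po₂ : IsPushout r u n c

  record TransPair (p₁ p₂ : Rule) : Set (o ⊔ ℓ ⊔ e ⊔ m) where
    constructor tpair
    field
      G  : Obj
      m₁ : Hom (Rule.L p₁) G
      m₂ : Hom (Rule.L p₂) G
      t₁ : DPO p₁ G m₁
      t₂ : DPO p₂ G m₂

  ParallelIndependent : ∀ {p₁ p₂} → TransPair p₁ p₂ → Set (ℓ ⊔ e)
  ParallelIndependent {p₁} {p₂} tp =
    (Σ[ d₁₂ ∈ Hom (Rule.L p₁) (DPO.D t₂) ] (DPO.k t₂ ∘ d₁₂ ≈ m₁)) ×
    (Σ[ d₂₁ ∈ Hom (Rule.L p₂) (DPO.D t₁) ] (DPO.k t₁ ∘ d₂₁ ≈ m₂))
    where open TransPair tp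

  record ExtDiagram {p : Rule} {K G : Obj} {o' : Hom (Rule.L p) K} {mt : Hom (Rule.L p) G}
         (t' : DPO p K o') (t : DPO p G mt) (f : Hom K G) : Set (o ⊔ ℓ ⊔ e) where
    private
      module U = DPO t'
      module W = DPO t
    field
      d : Hom U.D W.D
      h : Hom U.H W.H
      match-comm : mt ≈ f ∘ o'
      I-comm     : d ∘ U.u ≈ W.u
      R-comm     : h ∘ U.n ≈ W.n
      po-left    : IsPushout U.k d f W.k
      po-right   : IsPushout U.c d h W.c

  record Embedding {p₁ p₂ : Rule} (tp' tp : TransPair p₁ p₂) : Set (o ⊔ ℓ ⊔ e) where
    private
      module U = TransPair tp'
      module W = TransPair tp
    field
      f  : Hom U.G W.G
      e₁ : ExtDiagram U.t₁ W.t₁ f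
      e₂ : ExtDiagram U.t₂ W.t₂ f

  _≈Emb_ : ∀ {p₁ p₂} {tp' tp : TransPair p₁ p₂} → Embedding tp' tp → Embedding tp' tp → Set e
  E ≈Emb E' =
    (Embedding.f E ≈ Embedding.f E') ×
    (ExtDiagram.d (Embedding.e₁ E) ≈ ExtDiagram.d (Embedding.e₁ E')) ×
    (ExtDiagram.h (Embedding.e₁ E) ≈ ExtDiagram.h (Embedding.e₁ E')) ×
    (ExtDiagram.d (Embedding.e₂ E) ≈ ExtDiagram.d (Embedding.e₂ E')) ×
    (ExtDiagram.h (Embedding.e₂ E) ≈ ExtDiagram.h (Embedding.e₂ E'))

  IsInitialPair : ∀ {p₁ p₂} → TransPair p₁ p₂ → TransPair p₁ p₂ → Set (o ⊔ ℓ ⊔ e ⊔ m)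
  IsInitialPair {p₁} {p₂} tpI tp =
    Σ[ EI ∈ Embedding tpI tp ]
      (∀ (tp' : TransPair p₁ p₂) (E : Embedding tp' tp) →
        Σ[ E' ∈ Embedding tpI tp' ]
          ((Embedding.f E ∘ Embedding.f E' ≈ Embedding.f EI) ×
           (∀ (E'' : Embedding tpI tp') →
              Embedding.f E ∘ Embedding.f E'' ≈ Embedding.f EI → E'' ≈Emb E')))

module Submission where

-- The extension morphism of any embedding of the coproduct pair is forced to be [ m₁ , m₂ ],
-- and an extension diagram is determined by its extension morphism (k is mono and the right
-- square is a pushout); this gives uniqueness. For existence, pushout complements along M are
-- unique, so the context of p₁ at inj₁ is I₁ + L₂; the independence morphism d₂₁ : L₂ → D₁
-- then provides the context morphism [ u₁ , d₂₁ ], and the extension squares are pushouts by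
-- pasting. If another pair tp′ embeds into tp, the left squares of its extension diagrams are
-- pushouts along M, hence pullbacks, so the independence morphisms of tp lift to tp′, which is
-- therefore parallel independent and receives the same canonical embedding.

open import Level using (Level; _⊔_)
open import Data.Product using (Σ-syntax; _×_; _,_; proj₁; proj₂)
open import Relation.Binary using (IsEquivalence; Setoid)
import Relation.Binary.Reasoning.Setoid as SetoidReasoning
open import Defs

module HomReasoning {o ℓ e : Level} (𝒞 : Category o ℓ e) where
  open Category 𝒞

  hom-setoid : Obj → Obj → Setoid ℓ e
  hom-setoid A B = record { Carrier = Hom A B ; _≈_ = _≈_ ; isEquivalence = ≈-equiv }

  module _ {A B : Obj} where
    open IsEquivalence (≈-equiv {A} {B}) public using (refl; sym; trans)
    open SetoidReasoning (hom-setoid A B) public using (begin_; step-≈-⟩; step-≈-⟨; _∎)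

  ∘-resp-≈ˡ : ∀ {A B C} {f g : Hom B C} {h : Hom A B} → f ≈ g → f ∘ h ≈ g ∘ h
  ∘-resp-≈ˡ p = ∘-resp-≈ p refl

  ∘-resp-≈ʳ : ∀ {A B C} {f : Hom B C} {g h : Hom A B} → g ≈ h → f ∘ g ≈ f ∘ h
  ∘-resp-≈ʳ p = ∘-resp-≈ refl p

  sym-assoc : ∀ {A B C D} {f : Hom A B} {g : Hom B C} {h : Hom C D} →
              h ∘ (g ∘ f) ≈ (h ∘ g) ∘ f
  sym-assoc = sym assoc

module Squares {o ℓ e : Level} (𝒞 : Category o ℓ e) where
  open Category 𝒞
  open CatDefs 𝒞
  open HomReasoning 𝒞

  IsPushout-swap : ∀ {A B C P} {f : Hom A B} {g : Hom A C} {i₁ : Hom B P} {i₂ : Hom C P} →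
                   IsPushout f g i₁ i₂ → IsPushout g f i₂ i₁
  IsPushout-swap (comm , universal) = sym comm , λ h₁ h₂ eq →
    let (u , u∘i₁ , u∘i₂ , unique) = universal h₂ h₁ (sym eq)
    in u , u∘i₂ , u∘i₁ , λ v p q → unique v q p

  id-pushout : ∀ {A B} (f : Hom A B) → IsPushout f id id f
  id-pushout f = trans identityˡ (sym identityʳ) , λ h₁ h₂ eq →
    h₁ , identityʳ , trans eq identityʳ , λ v p _ → trans (sym identityʳ) p

  id-pullback : ∀ {A B} (f : Hom A B) → IsPullback f id id f
  id-pullback f = trans identityʳ (sym identityˡ) , λ h₁ h₂ eq →
    h₁ , identityˡ , trans eq identityˡ , λ v p _ → trans (sym identityˡ) p

  mono-pullback : ∀ {A B D} {f : Hom A D} {m′ : Hom B D} {g : Hom A B} →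
                  Mono m′ → f ≈ m′ ∘ g → IsPullback f m′ id g
  mono-pullback {f = f} {m′} {g} mono f≈m′g = trans identityʳ f≈m′g , λ h₁ h₂ eq →
    h₁ , identityˡ ,
    mono (g ∘ h₁) h₂ (begin
      m′ ∘ (g ∘ h₁) ≈⟨ sym-assoc ⟩
      (m′ ∘ g) ∘ h₁ ≈⟨ ∘-resp-≈ˡ f≈m′g ⟨
      f ∘ h₁        ≈⟨ eq ⟩
      m′ ∘ h₂       ∎) ,
    λ v p _ → trans (sym identityˡ) p

  pushout-along-id-split : ∀ {A B P} {i : Hom A B} {p : Hom B P} {u : Hom A P} →
                           IsPushout i id p u → Σ[ v ∈ Hom P B ] ((v ∘ u ≈ i) × (p ∘ v ≈ id))
  pushout-along-id-split {i = i} {p} {u} (comm , universal) =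
    let (v , v∘p , v∘u , _) = universal id i (trans identityˡ (sym identityʳ))
        (_ , _ , _ , unique) = universal p u comm
        pv∘p = begin
          (p ∘ v) ∘ p ≈⟨ assoc ⟩
          p ∘ (v ∘ p) ≈⟨ ∘-resp-≈ʳ v∘p ⟩
          p ∘ id      ≈⟨ identityʳ ⟩
          p           ∎
        pv∘u = begin
          (p ∘ v) ∘ u ≈⟨ assoc ⟩
          p ∘ (v ∘ u) ≈⟨ ∘-resp-≈ʳ v∘u ⟩
          p ∘ i       ≈⟨ comm ⟩
          u ∘ id      ≈⟨ identityʳ ⟩
          u           ∎
    in v , v∘u , trans (unique (p ∘ v) pv∘p pv∘u) (sym (unique id identityˡ identityˡ))

  pushout-unglue : ∀ {A B C P E Q} {f : Hom A B} {g : Hom A C} {i₁ : Hom B P} {i₂ : Hom C P}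
                     {h : Hom C E} {q₁ : Hom P Q} {q₂ : Hom E Q} {hg : Hom A E} {q₁i₁ : Hom B Q} →
                   IsPushout f g i₁ i₂ → IsPushout f hg q₁i₁ q₂ → hg ≈ h ∘ g → q₁i₁ ≈ q₁ ∘ i₁ →
                   q₁ ∘ i₂ ≈ q₂ ∘ h → IsPushout i₂ h q₁ q₂
  pushout-unglue {f = f} {g} {i₁} {i₂} {h} {q₁} {q₂} {hg} {q₁i₁}
                 (comm , universal) (_ , outer-universal) hg≈ q₁i₁≈ square =
    square , λ z₁ z₂ eq →
      let z₁-cocone = begin
            (z₁ ∘ i₁) ∘ f ≈⟨ assoc ⟩
            z₁ ∘ (i₁ ∘ f) ≈⟨ ∘-resp-≈ʳ comm ⟩
            z₁ ∘ (i₂ ∘ g) ≈⟨ sym-assoc ⟩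
            (z₁ ∘ i₂) ∘ g ∎
          outer-cocone = begin
            (z₁ ∘ i₁) ∘ f ≈⟨ z₁-cocone ⟩
            (z₁ ∘ i₂) ∘ g ≈⟨ ∘-resp-≈ˡ eq ⟩
            (z₂ ∘ h) ∘ g  ≈⟨ assoc ⟩
            z₂ ∘ (h ∘ g)  ≈⟨ ∘-resp-≈ʳ hg≈ ⟨
            z₂ ∘ hg       ∎
          (w , w∘q₁i₁ , w∘q₂ , w-unique) = outer-universal (z₁ ∘ i₁) z₂ outer-cocone
          (_ , _ , _ , z₁-unique) = universal (z₁ ∘ i₁) (z₁ ∘ i₂) z₁-cocone
          wq₁∘i₁ = begin
            (w ∘ q₁) ∘ i₁ ≈⟨ assoc ⟩
            w ∘ (q₁ ∘ i₁) ≈⟨ ∘-resp-≈ʳ q₁i₁≈ ⟨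
            w ∘ q₁i₁      ≈⟨ w∘q₁i₁ ⟩
            z₁ ∘ i₁       ∎
          wq₁∘i₂ = begin
            (w ∘ q₁) ∘ i₂ ≈⟨ assoc ⟩
            w ∘ (q₁ ∘ i₂) ≈⟨ ∘-resp-≈ʳ square ⟩
            w ∘ (q₂ ∘ h)  ≈⟨ sym-assoc ⟩
            (w ∘ q₂) ∘ h  ≈⟨ ∘-resp-≈ˡ w∘q₂ ⟩
            z₂ ∘ h        ≈⟨ eq ⟨
            z₁ ∘ i₂       ∎
      in w , trans (z₁-unique _ wq₁∘i₁ wq₁∘i₂) (sym (z₁-unique z₁ refl refl)) , w∘q₂ ,
         λ v v∘q₁ v∘q₂ → w-unique v (begin
           v ∘ q₁i₁      ≈⟨ ∘-resp-≈ʳ q₁i₁≈ ⟩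
           v ∘ (q₁ ∘ i₁) ≈⟨ sym-assoc ⟩
           (v ∘ q₁) ∘ i₁ ≈⟨ ∘-resp-≈ˡ v∘q₁ ⟩
           z₁ ∘ i₁       ∎) v∘q₂

module Coproducts {o ℓ e : Level} (𝒞 : Category o ℓ e) where
  open Category 𝒞
  open CatDefs 𝒞
  open HomReasoning 𝒞

  record IsCoproduct {A B S : Obj} (j : Hom A S) (j′ : Hom B S) : Set (o ⊔ ℓ ⊔ e) where
    field
      copair        : ∀ {X} → Hom A X → Hom B X → Hom S X
      copair∘j      : ∀ {X} {a : Hom A X} {b : Hom B X} → copair a b ∘ j ≈ a
      copair∘j′     : ∀ {X} {a : Hom A X} {b : Hom B X} → copair a b ∘ j′ ≈ b
      copair-unique : ∀ {X} {a : Hom A X} {b : Hom B X} (h : Hom S X) →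
                      h ∘ j ≈ a → h ∘ j′ ≈ b → h ≈ copair a b

    jointly-epic : ∀ {X} {h h′ : Hom S X} → h ∘ j ≈ h′ ∘ j → h ∘ j′ ≈ h′ ∘ j′ → h ≈ h′
    jointly-epic {h = h} {h′} p q = trans (copair-unique h p q) (sym (copair-unique h′ refl refl))

  module _ (cop : BinaryCoproducts) where
    open BinaryCoproducts cop

    +-isCoproduct : ∀ {A B} → IsCoproduct (inj₁ {A} {B}) inj₂
    +-isCoproduct = record
      { copair = [_,_] ; copair∘j = inject₁ ; copair∘j′ = inject₂ ; copair-unique = unique }

    +-isCoproduct-swap : ∀ {A B} → IsCoproduct (inj₂ {A} {B}) inj₁
    +-isCoproduct-swap = record
      { copair        = λ a b → [ b , a ]
      ; copair∘j      = inject₂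
      ; copair∘j′     = inject₁
      ; copair-unique = λ h p q → unique h q p
      }

    coproduct-pushout-complement :
      ∀ {I A B S} {j : Hom A S} {j′ : Hom B S} → IsCoproduct j j′ → (l : Hom I A) →
      IsPushout l inj₁ j [ j ∘ l , j′ ]
    coproduct-pushout-complement {j = j} {j′} S-coproduct l = sym inject₁ , λ h₁ h₂ eq →
      let open IsCoproduct S-coproduct
          u = copair h₁ (h₂ ∘ inj₂)
          u∘k∘inj₁ = begin
            (u ∘ [ j ∘ l , j′ ]) ∘ inj₁ ≈⟨ assoc ⟩
            u ∘ ([ j ∘ l , j′ ] ∘ inj₁) ≈⟨ ∘-resp-≈ʳ inject₁ ⟩
            u ∘ (j ∘ l)                 ≈⟨ sym-assoc ⟩
            (u ∘ j) ∘ l                 ≈⟨ ∘-resp-≈ˡ copair∘j ⟩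
            h₁ ∘ l                      ≈⟨ eq ⟩
            h₂ ∘ inj₁                   ∎
          u∘k∘inj₂ = begin
            (u ∘ [ j ∘ l , j′ ]) ∘ inj₂ ≈⟨ assoc ⟩
            u ∘ ([ j ∘ l , j′ ] ∘ inj₂) ≈⟨ ∘-resp-≈ʳ inject₂ ⟩
            u ∘ j′                      ≈⟨ copair∘j′ ⟩
            h₂ ∘ inj₂                   ∎
      in u , copair∘j , IsCoproduct.jointly-epic +-isCoproduct u∘k∘inj₁ u∘k∘inj₂ ,
         λ v v∘j v∘k → copair-unique v v∘j (begin
           v ∘ j′                      ≈⟨ ∘-resp-≈ʳ inject₂ ⟨
           v ∘ ([ j ∘ l , j′ ] ∘ inj₂) ≈⟨ sym-assoc ⟩
           (v ∘ [ j ∘ l , j′ ]) ∘ inj₂ ≈⟨ ∘-resp-≈ˡ v∘k ⟩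
           h₂ ∘ inj₂                   ∎)

module MAdhesiveProperties {o ℓ e m : Level} {𝒞 : Category o ℓ e} (𝓜 : MAdhesive 𝒞 m) where
  open Category 𝒞
  open CatDefs 𝒞
  open MAdhesive 𝓜
  open HomReasoning 𝒞
  open Squares 𝒞

  id∈M : ∀ {A} → M (id {A})
  id∈M = M-iso (id , identityˡ , identityˡ)

  M-pushout⇒pullback : ∀ {A B C D} {f : Hom A B} {m′ : Hom A C} {n : Hom B D} {g : Hom C D} →
                       IsPushout f m′ n g → M m′ → IsPullback g n m′ f
  -- Van Kampen for the cube over this pushout with the trivial pushout of f along id on top.
  M-pushout⇒pullback {f = f} {m′} {n} po m′∈M =
    proj₂ (proj₁ (vertical-weak-VK {f' = f} {m'' = id} {n' = id} {g' = f}
                                   {a = id} {b = id} {c = m′} {d = n}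
      po m′∈M
      (trans identityˡ (sym identityʳ))
      (trans identityʳ (sym identityˡ)) refl refl (sym (proj₁ po))
      id∈M m′∈M (M-pushout-stable po m′∈M)
      (id-pullback f) (mono-pullback (M-mono m′∈M) (sym identityʳ))) (id-pushout f))

  pushout-complement-comparison :
    ∀ {I L G Da Db} {l : Hom I L} {mt : Hom L G} {ua : Hom I Da} {ka : Hom Da G}
      {ub : Hom I Db} {kb : Hom Db G} →
    M l → IsPushout l ua mt ka → IsPushout l ub mt kb → M kb →
    Σ[ ψ ∈ Hom Db Da ] ((ψ ∘ ub ≈ ua) × (ka ∘ ψ ≈ kb))
  pushout-complement-comparison {Da = Da} {Db} {l} {_} {ua} {ka} {ub} {kb} l∈M poA poB kb∈M =
    let (_ , _ , _ , pb) = pullback-along-M ka kb kb∈M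
    in comparison-through pb
    where
      comparison-through : ∀ {P} {p₁ : Hom P Da} {p₂ : Hom P Db} → IsPullback ka kb p₁ p₂ →
                           Σ[ ψ ∈ Hom Db Da ] ((ψ ∘ ub ≈ ua) × (ka ∘ ψ ≈ kb))
      comparison-through {p₁ = p₁} {p₂} pb =
        -- In the cube over the first pushout whose front faces are the pullback pb and the
        -- second pushout (a pullback, being along M), van Kampen makes the top face, a pushout
        -- of i along id, so p₂ has a section v.
        let (i , p₁∘i , p₂∘i , _) = proj₂ pb ua ub (trans (sym (proj₁ poA)) (proj₁ poB))
            top-pushout = proj₂ (vertical-weak-VK {f' = i} {m'' = id} {n' = p₂} {g' = ub}
                                                  {a = id} {b = p₁} {c = l} {d = kb}
              (IsPushout-swap poA) l∈M
              (trans p₂∘i (sym identityʳ)) (trans identityʳ (sym p₁∘i)) refl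
              (proj₁ pb) (proj₁ poB)
              (M-pullback-stable pb kb∈M) l∈M kb∈M
              (mono-pullback (M-mono (M-pullback-stable pb kb∈M)) (sym p₁∘i))
              (mono-pullback (M-mono l∈M) (sym identityʳ)))
              (pb , M-pushout⇒pullback (IsPushout-swap poB) l∈M)
            (v , v∘ub , p₂∘v) = pushout-along-id-split top-pushout
        in p₁ ∘ v ,
           (begin
             (p₁ ∘ v) ∘ ub ≈⟨ assoc ⟩
             p₁ ∘ (v ∘ ub) ≈⟨ ∘-resp-≈ʳ v∘ub ⟩
             p₁ ∘ i        ≈⟨ p₁∘i ⟩
             ua            ∎) ,
           (begin
             ka ∘ (p₁ ∘ v) ≈⟨ sym-assoc ⟩
             (ka ∘ p₁) ∘ v ≈⟨ ∘-resp-≈ˡ (proj₁ pb) ⟩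
             (kb ∘ p₂) ∘ v ≈⟨ assoc ⟩
             kb ∘ (p₂ ∘ v) ≈⟨ ∘-resp-≈ʳ p₂∘v ⟩
             kb ∘ id       ≈⟨ identityʳ ⟩
             kb            ∎)

module Extensions {o ℓ e m : Level} {𝒞 : Category o ℓ e} (𝓜 : MAdhesive 𝒞 m) where
  open Category 𝒞
  open CatDefs 𝒞
  open MAdhesive 𝓜
  open Transformations 𝓜
  open HomReasoning 𝒞
  open Squares 𝒞
  open MAdhesiveProperties 𝓜

  DPO-k∈M : ∀ {p G mt} (t : DPO p G mt) → M (DPO.k t)
  DPO-k∈M {p} t = M-pushout-stable (IsPushout-swap (DPO.po₁ t)) (Rule.l∈M p)

  ExtDiagram-left-pullback : ∀ {p K G} {o′ : Hom (Rule.L p) K} {mt : Hom (Rule.L p) G}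
                               {t : DPO p K o′} {t′ : DPO p G mt} {f : Hom K G}
                             (E : ExtDiagram t t′ f) →
                             IsPullback f (DPO.k t′) (DPO.k t) (ExtDiagram.d E)
  ExtDiagram-left-pullback {t = t} E =
    M-pushout⇒pullback (IsPushout-swap (ExtDiagram.po-left E)) (DPO-k∈M t)

  ExtDiagram-unique : ∀ {p K G} {o′ : Hom (Rule.L p) K} {mt : Hom (Rule.L p) G}
                        {t : DPO p K o′} {t′ : DPO p G mt} {f f′ : Hom K G}
                      (X : ExtDiagram t t′ f) (Y : ExtDiagram t t′ f′) → f ≈ f′ →
                      (ExtDiagram.d X ≈ ExtDiagram.d Y) × (ExtDiagram.h X ≈ ExtDiagram.h Y)
  ExtDiagram-unique {p} {t = t} {t′} {f} {f′} X Y f≈f′ = d≈ , h≈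
    where
      module T = DPO t
      module T′ = DPO t′
      module X = ExtDiagram X
      module Y = ExtDiagram Y
      d≈ : X.d ≈ Y.d
      d≈ = M-mono (DPO-k∈M t′) X.d Y.d (begin
        T′.k ∘ X.d ≈⟨ proj₁ X.po-left ⟨
        f ∘ T.k    ≈⟨ ∘-resp-≈ˡ f≈f′ ⟩
        f′ ∘ T.k   ≈⟨ proj₁ Y.po-left ⟩
        T′.k ∘ Y.d ∎)
      Yh-cocone : (Y.h ∘ T.n) ∘ Rule.r p ≈ (Y.h ∘ T.c) ∘ T.u
      Yh-cocone = begin
        (Y.h ∘ T.n) ∘ Rule.r p ≈⟨ assoc ⟩
        Y.h ∘ (T.n ∘ Rule.r p) ≈⟨ ∘-resp-≈ʳ (proj₁ T.po₂) ⟩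
        Y.h ∘ (T.c ∘ T.u)      ≈⟨ sym-assoc ⟩
        (Y.h ∘ T.c) ∘ T.u      ∎
      Yh-unique = proj₂ (proj₂ (proj₂ (proj₂ T.po₂ (Y.h ∘ T.n) (Y.h ∘ T.c) Yh-cocone)))
      h≈ : X.h ≈ Y.h
      h≈ = trans (Yh-unique X.h (trans X.R-comm (sym Y.R-comm)) (begin
                   X.h ∘ T.c  ≈⟨ proj₁ X.po-right ⟩
                   T′.c ∘ X.d ≈⟨ ∘-resp-≈ʳ d≈ ⟩
                   T′.c ∘ Y.d ≈⟨ proj₁ Y.po-right ⟨
                   Y.h ∘ T.c  ∎))
                 (sym (Yh-unique Y.h refl refl))

  independence-reflected : ∀ {p₁ p₂} {tp′ tp : TransPair p₁ p₂} →
                           Embedding tp′ tp → ParallelIndependent tp → ParallelIndependent tp′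
  independence-reflected E ((d₁₂ , k₂∘d₁₂) , (d₂₁ , k₁∘d₂₁)) =
    lift (ExtDiagram-left-pullback E.e₂) (trans (sym (ExtDiagram.match-comm E.e₁)) (sym k₂∘d₁₂)) ,
    lift (ExtDiagram-left-pullback E.e₁) (trans (sym (ExtDiagram.match-comm E.e₂)) (sym k₁∘d₂₁))
    where
      module E = Embedding E
      lift : ∀ {A B C D X} {f : Hom A D} {g : Hom B D} {π₁ : Hom C A} {π₂ : Hom C B}
               {x : Hom X A} {y : Hom X B} →
             IsPullback f g π₁ π₂ → f ∘ x ≈ g ∘ y → Σ[ z ∈ Hom X C ] (π₁ ∘ z ≈ x)
      lift pb eq = let (z , π₁∘z , _) = proj₂ pb _ _ eq in z , π₁∘z

module CoproductMatches {o ℓ e m : Level} {𝒞 : Category o ℓ e} (𝓜 : MAdhesive 𝒞 m)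
                        (cop : CatDefs.BinaryCoproducts 𝒞) where
  open Category 𝒞
  open CatDefs 𝒞
  open BinaryCoproducts cop
  open Transformations 𝓜
  open HomReasoning 𝒞
  open Squares 𝒞
  open Coproducts 𝒞
  open MAdhesiveProperties 𝓜
  open Extensions 𝓜

  coproduct-match-extension :
    ∀ {p : Rule} {B S K} {j : Hom (Rule.L p) S} {j′ : Hom B S} → IsCoproduct j j′ →
    {o′ : Hom (Rule.L p) K} {o″ : Hom B K} (t : DPO p S j) (t′ : DPO p K o′)
    (g : Hom B (DPO.D t′)) → DPO.k t′ ∘ g ≈ o″ →
    (f : Hom S K) → f ∘ j ≈ o′ → f ∘ j′ ≈ o″ → ExtDiagram t t′ f
  coproduct-match-extension {p} {B} {j = j} {j′} S-coproduct {o′} {o″} t t′ g k′∘g f f∘j f∘j′ =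
    record
      { d          = d
      ; h          = h
      ; match-comm = sym f∘j
      ; I-comm     = d∘u
      ; R-comm     = h∘n
      ; po-left    = pushout-unglue T.po₁ T′.po₁ (sym d∘u) (sym f∘j) f∘k
      ; po-right   = pushout-unglue T.po₂ T′.po₂ (sym d∘u) (sym h∘n) h∘c
      }
    where
      open Rule p
      module T = DPO t
      module T′ = DPO t′
      -- Pushout complements along M are unique, so the context of t is the canonical
      -- complement I + B; this is what lets d be defined by cases.
      comparison = pushout-complement-comparison l∈M
                     (coproduct-pushout-complement cop S-coproduct l) T.po₁ (DPO-k∈M t)
      ψ : Hom T.D (I + B)
      ψ = proj₁ comparison
      d = [ T′.u , g ] ∘ ψ
      d∘u : d ∘ T.u ≈ T′.u
      d∘u = begin
        ([ T′.u , g ] ∘ ψ) ∘ T.u ≈⟨ assoc ⟩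
        [ T′.u , g ] ∘ (ψ ∘ T.u) ≈⟨ ∘-resp-≈ʳ (proj₁ (proj₂ comparison)) ⟩
        [ T′.u , g ] ∘ inj₁      ≈⟨ inject₁ ⟩
        T′.u                     ∎
      f∘[j∘l,j′] : f ∘ [ j ∘ l , j′ ] ≈ T′.k ∘ [ T′.u , g ]
      f∘[j∘l,j′] = IsCoproduct.jointly-epic (+-isCoproduct cop)
        (begin
          (f ∘ [ j ∘ l , j′ ]) ∘ inj₁ ≈⟨ assoc ⟩
          f ∘ ([ j ∘ l , j′ ] ∘ inj₁) ≈⟨ ∘-resp-≈ʳ inject₁ ⟩
          f ∘ (j ∘ l)                 ≈⟨ sym-assoc ⟩
          (f ∘ j) ∘ l                 ≈⟨ ∘-resp-≈ˡ f∘j ⟩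
          o′ ∘ l                      ≈⟨ proj₁ T′.po₁ ⟩
          T′.k ∘ T′.u                 ≈⟨ ∘-resp-≈ʳ inject₁ ⟨
          T′.k ∘ ([ T′.u , g ] ∘ inj₁) ≈⟨ sym-assoc ⟩
          (T′.k ∘ [ T′.u , g ]) ∘ inj₁ ∎)
        (begin
          (f ∘ [ j ∘ l , j′ ]) ∘ inj₂ ≈⟨ assoc ⟩
          f ∘ ([ j ∘ l , j′ ] ∘ inj₂) ≈⟨ ∘-resp-≈ʳ inject₂ ⟩
          f ∘ j′                      ≈⟨ f∘j′ ⟩
          o″                          ≈⟨ k′∘g ⟨
          T′.k ∘ g                    ≈⟨ ∘-resp-≈ʳ inject₂ ⟨
          T′.k ∘ ([ T′.u , g ] ∘ inj₂) ≈⟨ sym-assoc ⟩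
          (T′.k ∘ [ T′.u , g ]) ∘ inj₂ ∎)
      f∘k : f ∘ T.k ≈ T′.k ∘ d
      f∘k = begin
        f ∘ T.k                      ≈⟨ ∘-resp-≈ʳ (proj₂ (proj₂ comparison)) ⟨
        f ∘ ([ j ∘ l , j′ ] ∘ ψ)     ≈⟨ sym-assoc ⟩
        (f ∘ [ j ∘ l , j′ ]) ∘ ψ     ≈⟨ ∘-resp-≈ˡ f∘[j∘l,j′] ⟩
        (T′.k ∘ [ T′.u , g ]) ∘ ψ    ≈⟨ assoc ⟩
        T′.k ∘ d                     ∎
      h-cocone : T′.n ∘ r ≈ (T′.c ∘ d) ∘ T.u
      h-cocone = begin
        T′.n ∘ r          ≈⟨ proj₁ T′.po₂ ⟩
        T′.c ∘ T′.u       ≈⟨ ∘-resp-≈ʳ d∘u ⟨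
        T′.c ∘ (d ∘ T.u)  ≈⟨ sym-assoc ⟩
        (T′.c ∘ d) ∘ T.u  ∎
      h-universal = proj₂ T.po₂ T′.n (T′.c ∘ d) h-cocone
      h = proj₁ h-universal
      h∘n : h ∘ T.n ≈ T′.n
      h∘n = proj₁ (proj₂ h-universal)
      h∘c : h ∘ T.c ≈ T′.c ∘ d
      h∘c = proj₁ (proj₂ (proj₂ h-universal))

module CoproductPair {o ℓ e m : Level} {𝒞 : Category o ℓ e} (𝓜 : MAdhesive 𝒞 m)
                     (cop : CatDefs.BinaryCoproducts 𝒞) (p₁ p₂ : Transformations.Rule 𝓜) where
  open Category 𝒞
  open CatDefs 𝒞
  open BinaryCoproducts cop
  open Transformations 𝓜
  open HomReasoning 𝒞
  open Coproducts 𝒞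
  open Extensions 𝓜
  open CoproductMatches 𝓜 cop

  module _ (t₁ : DPO p₁ (Rule.L p₁ + Rule.L p₂) inj₁)
           (t₂ : DPO p₂ (Rule.L p₁ + Rule.L p₂) inj₂) where

    coproduct-pair : TransPair p₁ p₂
    coproduct-pair = tpair (Rule.L p₁ + Rule.L p₂) inj₁ inj₂ t₁ t₂

    coproduct-pair-embedding : (tp : TransPair p₁ p₂) → ParallelIndependent tp →
                               Embedding coproduct-pair tp
    coproduct-pair-embedding (tpair _ m₁ m₂ T₁ T₂) ((d₁₂ , k₂∘d₁₂) , (d₂₁ , k₁∘d₂₁)) = record
      { f  = [ m₁ , m₂ ]
      ; e₁ = coproduct-match-extension (+-isCoproduct cop) t₁ T₁ d₂₁ k₁∘d₂₁
                                       [ m₁ , m₂ ] inject₁ inject₂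
      ; e₂ = coproduct-match-extension (+-isCoproduct-swap cop) t₂ T₂ d₁₂ k₂∘d₁₂
                                       [ m₁ , m₂ ] inject₂ inject₁
      }

    coproduct-pair-embeddings-unique : ∀ {tp : TransPair p₁ p₂}
                                       (E E′ : Embedding coproduct-pair tp) → E ≈Emb E′
    coproduct-pair-embeddings-unique E E′ =
      f≈ , proj₁ d₁h₁≈ , proj₂ d₁h₁≈ , proj₁ d₂h₂≈ , proj₂ d₂h₂≈
      where
        module E = Embedding E
        module E′ = Embedding E′
        f≈ : E.f ≈ E′.f
        f≈ = IsCoproduct.jointly-epic (+-isCoproduct cop)
               (trans (sym (ExtDiagram.match-comm E.e₁)) (ExtDiagram.match-comm E′.e₁))
               (trans (sym (ExtDiagram.match-comm E.e₂)) (ExtDiagram.match-comm E′.e₂))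
        d₁h₁≈ = ExtDiagram-unique E.e₁ E′.e₁ f≈
        d₂h₂≈ = ExtDiagram-unique E.e₂ E′.e₂ f≈

    embedding-composite : ∀ {tp′ tp : TransPair p₁ p₂}
                          (E : Embedding tp′ tp) (E′ : Embedding coproduct-pair tp′) →
                          Embedding.f E ∘ Embedding.f E′ ≈ [ TransPair.m₁ tp , TransPair.m₂ tp ]
    embedding-composite {tpair _ o₁ o₂ _ _} {tpair _ m₁ m₂ _ _} E E′ = unique _
      (begin
        (E.f ∘ E′.f) ∘ inj₁ ≈⟨ assoc ⟩
        E.f ∘ (E′.f ∘ inj₁) ≈⟨ ∘-resp-≈ʳ (ExtDiagram.match-comm E′.e₁) ⟨
        E.f ∘ o₁            ≈⟨ ExtDiagram.match-comm E.e₁ ⟨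
        m₁                  ∎)
      (begin
        (E.f ∘ E′.f) ∘ inj₂ ≈⟨ assoc ⟩
        E.f ∘ (E′.f ∘ inj₂) ≈⟨ ∘-resp-≈ʳ (ExtDiagram.match-comm E′.e₂) ⟨
        E.f ∘ o₂            ≈⟨ ExtDiagram.match-comm E.e₂ ⟨
        m₂                  ∎)
      where
        module E = Embedding E
        module E′ = Embedding E′

lemma3 : ∀ {o ℓ e m : Level} {𝒞 : Category o ℓ e} (𝓜 : MAdhesive 𝒞 m)
           (cop : CatDefs.BinaryCoproducts 𝒞)
           (p₁ p₂ : Transformations.Rule 𝓜)
           (tp : Transformations.TransPair 𝓜 p₁ p₂) →
           Transformations.ParallelIndependent 𝓜 tp →
           let open CatDefs.BinaryCoproducts cop
               L₁ = Transformations.Rule.L p₁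
               L₂ = Transformations.Rule.L p₂
           in (t₁ : Transformations.DPO 𝓜 p₁ (L₁ + L₂) inj₁)
              (t₂ : Transformations.DPO 𝓜 p₂ (L₁ + L₂) inj₂) →
              Transformations.IsInitialPair 𝓜
                (Transformations.tpair (L₁ + L₂) inj₁ inj₂ t₁ t₂) tp
lemma3 𝓜 cop p₁ p₂ tp independent t₁ t₂ =
  coproduct-pair-embedding t₁ t₂ tp independent ,
  λ tp′ E →
    let E′ = coproduct-pair-embedding t₁ t₂ tp′ (independence-reflected E independent)
    in E′ , embedding-composite t₁ t₂ E E′ ,
       λ E″ _ → coproduct-pair-embeddings-unique t₁ t₂ E″ E′
  where
    open Extensions 𝓜
    open CoproductPair 𝓜 cop p₁ p₂
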